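{- Let $n$ be a positive integer and let $$A_n:=\sum_{k=0}^{n-1}(-1)^{n-1-k}\binom{2k}{k}^5(205k^2+160k+32).$$ Then $$A_n=16n\binom{2n}{n}\sum_{k=0}^{n-1}\binom{n+k-1}{k}^4(2k+n)$$ and $$A_n=8n^2\binom{2n}{n}^2\sum_{k=0}^{n-1}(-1)^k\binom{2n-1}{n+k}\binom{2n-k-2}{n-k-1}^2.$$ -}

module Defs where

open import Data.Nat using (ℕ; zero; suc; _∸_)
open import Data.Integer using (ℤ; +_; -_; _+_; _*_)

sumTo : ℕ → (ℕ → ℤ) → ℤ
sumTo zero    f = + 0
sumTo (suc n) f = sumTo n f + f n

sign : ℕ → ℤ
sign zero    = + 1
sign (suc m) = - sign m

module Submission where

-- Each of the three expressions x(n) satisfies x(0) = 0 and x(n+1) + x(n) = C(2n,n)^5 (205n² + 160n + 32), which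
-- determines it; for A_n this is immediate. For the other two it comes from Wilf–Zeilberger-type pairs. With
-- F₁(n,k) = n C(2n,n) C(n+k-1,k)^4 (2k+n) there is an explicit G₁ with F₁(n+1,k) + F₁(n,k) = G₁(n,k+1) - G₁(n,k),
-- so summing over k leaves only a boundary term. Likewise F₂(n,k) = 8n² C(2n,n)² C(2n-1,n+k) C(2n-k-2,n-k-1)²
-- satisfies F₂(n+1,k+1) = F₂(n,k) + 4 C(2n,n)² (G₂(n,n-k) + G₂(n,n-k-1)), and the alternating sum over k telescopes.
-- Since neighbouring binomial coefficients have rational ratios, each pair identity becomes a polynomial identity
-- after clearing a common product of binomials.

open import Defs

module Binomial where

  open import Data.Nat
  open import Data.Nat.Properties
  open import Data.Nat.Combinatorics
  open import Data.Nat.DivMod using (m/n*n≡m)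
  open import Data.Nat.Tactic.RingSolver using (solve-∀)
  open import Relation.Binary.PropositionalEquality
  open ≡-Reasoning
  open import Algebra.Properties.CommutativeSemigroup *-commutativeSemigroup
    using (x∙yz≈y∙xz; x∙yz≈yx∙z)

  -- Indexing by the two parts of the top avoids truncated subtraction.
  bin : ℕ → ℕ → ℕ
  bin a b = (a + b) C b

  bin-*-factorials : ∀ a b → bin a b * (a ! * b !) ≡ (a + b) !
  bin-*-factorials a b = begin
    bin a b * (a ! * b !)                    ≡⟨ cong (λ c → bin a b * (c ! * b !)) (sym (m+n∸n≡m a b)) ⟩
    bin a b * ((a + b ∸ b) ! * b !)          ≡⟨ cong (bin a b *_) (*-comm ((a + b ∸ b) !) (b !)) ⟩
    bin a b * (b ! * (a + b ∸ b) !)          ≡⟨ cong (_* (b ! * (a + b ∸ b) !)) (nCk≡n!/k![n-k]! b≤a+b) ⟩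
    (a + b) ! / (b ! * (a + b ∸ b) !) * (b ! * (a + b ∸ b) !) ≡⟨ m/n*n≡m (k![n∸k]!∣n! b≤a+b) ⟩
    (a + b) !                                ∎
    where
    b≤a+b = m≤n+m b a
    instance _ = b !* (a + b ∸ b) !≢0

  bin-sym : ∀ a b → bin a b ≡ bin b a
  bin-sym a b = begin
    (a + b) C b           ≡⟨ nCk≡nC[n∸k] (m≤n+m b a) ⟩
    (a + b) C (a + b ∸ b) ≡⟨ cong₂ _C_ (+-comm a b) (m+n∸n≡m a b) ⟩
    (b + a) C a           ∎

  bin-sucʳ : ∀ a b → bin a (suc b) * suc b ≡ bin a b * suc (a + b)
  bin-sucʳ a b = *-cancelʳ-≡ _ _ (a ! * b !) {{a !* b !≢0}} (begin
    bin a (suc b) * suc b * (a ! * b !)   ≡⟨ *-assoc (bin a (suc b)) (suc b) (a ! * b !) ⟩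
    bin a (suc b) * (suc b * (a ! * b !)) ≡⟨ cong (bin a (suc b) *_) (x∙yz≈y∙xz (suc b) (a !) (b !)) ⟩
    bin a (suc b) * (a ! * suc b !)       ≡⟨ bin-*-factorials a (suc b) ⟩
    (a + suc b) !                         ≡⟨ cong _! (+-suc a b) ⟩
    suc (a + b) * (a + b) !               ≡⟨ cong (suc (a + b) *_) (bin-*-factorials a b) ⟨
    suc (a + b) * (bin a b * (a ! * b !)) ≡⟨ x∙yz≈yx∙z (suc (a + b)) (bin a b) (a ! * b !) ⟩
    bin a b * suc (a + b) * (a ! * b !)   ∎)

  bin-sucˡ : ∀ a b → bin (suc a) b * suc a ≡ bin a b * suc (a + b)
  bin-sucˡ a b = begin
    bin (suc a) b * suc a ≡⟨ cong (_* suc a) (bin-sym (suc a) b) ⟩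
    bin b (suc a) * suc a ≡⟨ bin-sucʳ b a ⟩
    bin b a * suc (b + a) ≡⟨ cong₂ (λ x y → x * suc y) (bin-sym b a) (+-comm b a) ⟩
    bin a b * suc (a + b) ∎

  bin-shift : ∀ a b → bin (suc a) b * suc a ≡ bin a (suc b) * suc b
  bin-shift a b = trans (bin-sucˡ a b) (sym (bin-sucʳ a b))

  central : ℕ → ℕ
  central n = (2 * n) C n

  central≡bin : ∀ n → central n ≡ bin n n
  central≡bin n = cong (λ m → (n + m) C n) (+-identityʳ n)

  central-suc≡2*bin : ∀ m → central (suc m) ≡ 2 * bin m (suc m)
  central-suc≡2*bin m = *-cancelʳ-≡ _ _ (suc m) (begin
    central (suc m) * suc m             ≡⟨ cong (_* suc m) (central≡bin (suc m)) ⟩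
    bin (suc m) (suc m) * suc m         ≡⟨ bin-sucˡ m (suc m) ⟩
    bin m (suc m) * suc (m + suc m)     ≡⟨ rearrange m (bin m (suc m)) ⟩
    2 * bin m (suc m) * suc m           ∎)
    where
    rearrange : ∀ m c → c * suc (m + suc m) ≡ 2 * c * suc m
    rearrange = solve-∀

  central-suc : ∀ n → suc n * central (suc n) ≡ 2 * (2 * n + 1) * central n
  central-suc n = *-cancelʳ-≡ _ _ (suc n) (begin
    suc n * central (suc n) * suc n             ≡⟨ cong (λ c → suc n * c * suc n) (central≡bin (suc n)) ⟩
    suc n * bin (suc n) (suc n) * suc n         ≡⟨ *-assoc (suc n) (bin (suc n) (suc n)) (suc n) ⟩
    suc n * (bin (suc n) (suc n) * suc n)       ≡⟨ cong (suc n *_) (bin-sucʳ (suc n) n) ⟩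
    suc n * (bin (suc n) n * suc (suc n + n))   ≡⟨ x∙yz≈yx∙z (suc n) (bin (suc n) n) (suc (suc n + n)) ⟩
    bin (suc n) n * suc n * suc (suc n + n)     ≡⟨ cong (_* suc (suc n + n)) (bin-sucˡ n n) ⟩
    bin n n * suc (n + n) * suc (suc n + n)     ≡⟨ rearrange n (bin n n) ⟩
    2 * (2 * n + 1) * bin n n * suc n           ≡⟨ cong (λ c → 2 * (2 * n + 1) * c * suc n) (central≡bin n) ⟨
    2 * (2 * n + 1) * central n * suc n         ∎)
    where
    rearrange : ∀ n c → c * suc (n + n) * suc (suc n + n) ≡ 2 * (2 * n + 1) * c * suc n
    rearrange = solve-∀

module Sums where

  open import Data.Nat as ℕ using (ℕ; zero; suc; _<_; _∸_)
  import Data.Nat.Properties as ℕ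
  open import Data.Integer using (ℤ; +_; -_; _+_; _*_; _-_)
  open import Data.Integer.Properties
    using (+-comm; +-assoc; *-zeroʳ; *-distribˡ-+; neg-distrib-+; pos-+; +-0-abelianGroup; +-commutativeSemigroup)
  import Algebra.Properties.CommutativeSemigroup as CommutativeSemigroupProperties
  module ℤ+ = CommutativeSemigroupProperties +-commutativeSemigroup
  module ℕ+ = CommutativeSemigroupProperties ℕ.+-commutativeSemigroup
  open import Algebra.Properties.AbelianGroup +-0-abelianGroup using (∙-cancelʳ)
  open import Data.Integer.Tactic.RingSolver using (solve-∀)
  open import Relation.Binary.PropositionalEquality
  open ≡-Reasoning

  sumTo-cong : ∀ n {f g : ℕ → ℤ} → (∀ {k} → k < n → f k ≡ g k) → sumTo n f ≡ sumTo n g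
  sumTo-cong zero    f≡g = refl
  sumTo-cong (suc n) f≡g = cong₂ _+_ (sumTo-cong n (λ k<n → f≡g (ℕ.m<n⇒m<1+n k<n))) (f≡g (ℕ.n<1+n n))

  sumTo-+ : ∀ n (f g : ℕ → ℤ) → sumTo n (λ k → f k + g k) ≡ sumTo n f + sumTo n g
  sumTo-+ zero    f g = refl
  sumTo-+ (suc n) f g =
    trans (cong (_+ (f n + g n)) (sumTo-+ n f g)) (ℤ+.interchange (sumTo n f) (sumTo n g) (f n) (g n))

  sumTo-*ˡ : ∀ n c (f : ℕ → ℤ) → sumTo n (λ k → c * f k) ≡ c * sumTo n f
  sumTo-*ˡ zero    c f = sym (*-zeroʳ c)
  sumTo-*ˡ (suc n) c f = trans (cong (_+ c * f n) (sumTo-*ˡ n c f)) (sym (*-distribˡ-+ c (sumTo n f) (f n)))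

  sumTo-neg : ∀ n (f : ℕ → ℤ) → sumTo n (λ k → - f k) ≡ - sumTo n f
  sumTo-neg zero    f = refl
  sumTo-neg (suc n) f = trans (cong (_+ - f n) (sumTo-neg n f)) (sym (neg-distrib-+ (sumTo n f) (f n)))

  sumTo-suc : ∀ n (f : ℕ → ℤ) → sumTo (suc n) f ≡ f 0 + sumTo n (λ k → f (suc k))
  sumTo-suc zero    f = +-comm (+ 0) (f 0)
  sumTo-suc (suc n) f = trans (cong (_+ f (suc n)) (sumTo-suc n f)) (+-assoc (f 0) _ (f (suc n)))

  sumTo-alternating-telescope : ∀ n (h : ℕ → ℤ) →
    sumTo n (λ k → sign k * (h k + h (suc k))) ≡ h 0 - sign n * h n
  sumTo-alternating-telescope zero    h = sym (cancel (h 0))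
    where
    cancel : ∀ x → x - + 1 * x ≡ + 0
    cancel = solve-∀
  sumTo-alternating-telescope (suc n) h =
    trans (cong (_+ sign n * (h n + h (suc n))) (sumTo-alternating-telescope n h))
          (step (h 0) (sign n) (h n) (h (suc n)))
    where
    step : ∀ x s y z → x - s * y + s * (y + z) ≡ x - (- s) * z
    step = solve-∀

  sumTo-alternating-shift : ∀ n (a b h : ℕ → ℤ) →
    (∀ {k} → k < n → b (suc k) ≡ a k + (h k + h (suc k))) →
    sumTo (suc n) (λ k → sign k * b k) + sumTo n (λ k → sign k * a k) ≡ b 0 - (h 0 - sign n * h n)
  sumTo-alternating-shift n a b h b≡a+h = begin
    sumTo (suc n) (λ k → sign k * b k) + Σa
      ≡⟨ cong (_+ Σa) (sumTo-suc n (λ k → sign k * b k)) ⟩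
    + 1 * b 0 + sumTo n (λ k → - sign k * b (suc k)) + Σa
      ≡⟨ cong (λ s → + 1 * b 0 + s + Σa) (sumTo-cong n (λ {k} k<n → cong (λ x → - sign k * x) (b≡a+h k<n))) ⟩
    + 1 * b 0 + sumTo n (λ k → - sign k * (a k + (h k + h (suc k)))) + Σa
      ≡⟨ cong (λ s → + 1 * b 0 + s + Σa) (sumTo-cong n (λ {k} _ → distribute (sign k) (a k) (h k + h (suc k)))) ⟩
    + 1 * b 0 + sumTo n (λ k → - (sign k * a k + sign k * (h k + h (suc k)))) + Σa
      ≡⟨ cong (λ s → + 1 * b 0 + s + Σa) (sumTo-neg n _) ⟩
    + 1 * b 0 - sumTo n (λ k → sign k * a k + sign k * (h k + h (suc k))) + Σa
      ≡⟨ cong (λ s → + 1 * b 0 - s + Σa) (sumTo-+ n _ _) ⟩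
    + 1 * b 0 - (Σa + sumTo n (λ k → sign k * (h k + h (suc k)))) + Σa
      ≡⟨ cong (λ s → + 1 * b 0 - (Σa + s) + Σa) (sumTo-alternating-telescope n h) ⟩
    + 1 * b 0 - (Σa + (h 0 - sign n * h n)) + Σa
      ≡⟨ simplify (b 0) Σa (h 0 - sign n * h n) ⟩
    b 0 - (h 0 - sign n * h n) ∎
    where
    Σa = sumTo n (λ k → sign k * a k)
    distribute : ∀ s x y → - s * (x + y) ≡ - (s * x + s * y)
    distribute = solve-∀
    simplify : ∀ x y z → + 1 * x - (y + z) + y ≡ x - z
    simplify = solve-∀

  sumTo-reversed-alternating : ∀ n (a b : ℕ → ℤ) →
    sumTo (suc n) (λ k → sign (n ∸ k) * a k * b k) + sumTo n (λ k → sign (n ∸ 1 ∸ k) * a k * b k) ≡ a n * b n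
  sumTo-reversed-alternating n a b = begin
    sumTo n (λ k → sign (n ∸ k) * a k * b k) + sign (n ∸ n) * a n * b n + S
      ≡⟨ cong₂ (λ s m → s + sign m * a n * b n + S) (sumTo-cong n flip) (ℕ.n∸n≡0 n) ⟩
    sumTo n (λ k → - (sign (n ∸ 1 ∸ k) * a k * b k)) + + 1 * a n * b n + S
      ≡⟨ cong (λ s → s + + 1 * a n * b n + S) (sumTo-neg n _) ⟩
    - S + + 1 * a n * b n + S
      ≡⟨ simplify S (a n) (b n) ⟩
    a n * b n ∎
    where
    S = sumTo n (λ k → sign (n ∸ 1 ∸ k) * a k * b k)
    negate : ∀ s x y → - s * x * y ≡ - (s * x * y)
    negate = solve-∀
    simplify : ∀ s x y → - s + + 1 * x * y + s ≡ x * y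
    simplify = solve-∀
    flip : ∀ {k} → k < n → sign (n ∸ k) * a k * b k ≡ - (sign (n ∸ 1 ∸ k) * a k * b k)
    flip {k} (ℕ.s≤s k≤n-1) =
      trans (cong (λ m → sign m * a k * b k) (ℕ.+-∸-assoc 1 k≤n-1)) (negate (sign (n ∸ 1 ∸ k)) (a k) (b k))

  recurrence-unique : ∀ (x y t : ℕ → ℤ) → x 0 ≡ y 0 →
    (∀ n → x (suc n) + x n ≡ t n) → (∀ n → y (suc n) + y n ≡ t n) → ∀ n → x n ≡ y n
  recurrence-unique x y t x₀≡y₀ x-rec y-rec zero    = x₀≡y₀
  recurrence-unique x y t x₀≡y₀ x-rec y-rec (suc n) =
    ∙-cancelʳ (x n) (x (suc n)) (y (suc n)) (trans (x-rec n) (trans (sym (y-rec n)) (cong (_+_ (y (suc n))) (sym xₙ≡yₙ))))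
    where
    xₙ≡yₙ = recurrence-unique x y t x₀≡y₀ x-rec y-rec n

  sumℕ : ℕ → (ℕ → ℕ) → ℕ
  sumℕ zero    f = 0
  sumℕ (suc n) f = sumℕ n f ℕ.+ f n

  sumTo-pos : ∀ n (f : ℕ → ℕ) → sumTo n (λ k → + f k) ≡ + sumℕ n f
  sumTo-pos zero    f = refl
  sumTo-pos (suc n) f = trans (cong (_+ + f n) (sumTo-pos n f)) (sym (pos-+ (sumℕ n f) (f n)))

  sumℕ-+ : ∀ n (f g : ℕ → ℕ) → sumℕ n (λ k → f k ℕ.+ g k) ≡ sumℕ n f ℕ.+ sumℕ n g
  sumℕ-+ zero    f g = refl
  sumℕ-+ (suc n) f g =
    trans (cong (ℕ._+ (f n ℕ.+ g n)) (sumℕ-+ n f g)) (ℕ+.interchange (sumℕ n f) (sumℕ n g) (f n) (g n))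

  sumℕ-*ˡ : ∀ n c (f : ℕ → ℕ) → sumℕ n (λ k → c ℕ.* f k) ≡ c ℕ.* sumℕ n f
  sumℕ-*ˡ zero    c f = sym (ℕ.*-zeroʳ c)
  sumℕ-*ˡ (suc n) c f = trans (cong (ℕ._+ c ℕ.* f n) (sumℕ-*ˡ n c f)) (sym (ℕ.*-distribˡ-+ c (sumℕ n f) (f n)))

  sumℕ-telescope : ∀ n (f g : ℕ → ℕ) → g 0 ≡ 0 → (∀ k → f k ℕ.+ g k ≡ g (suc k)) → sumℕ n f ≡ g n
  sumℕ-telescope zero    f g g₀≡0 step = sym g₀≡0
  sumℕ-telescope (suc n) f g g₀≡0 step =
    trans (cong (ℕ._+ f n) (sumℕ-telescope n f g g₀≡0 step)) (trans (ℕ.+-comm (g n) (f n)) (step n))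

module FirstIdentity where

  open import Data.List using (_∷_; [])
  open import Data.Nat
  open import Data.Nat.Properties
  open import Data.Nat.Combinatorics using (_C_)
  open import Data.Nat.Tactic.RingSolver using (solve; solve-∀)
  open import Relation.Binary.PropositionalEquality
  open ≡-Reasoning
  open Binomial
  open Sums using (sumℕ; sumℕ-+; sumℕ-*ˡ; sumℕ-telescope)

  -- The ring solver does not recognise ℕ's _^_, so powers are multiplied out before it is called.
  ^4-unfold : ∀ x → x ^ 4 ≡ x * x * x * x
  ^4-unfold x = begin
    x * (x * (x * (x * 1))) ≡⟨ cong (λ y → x * (x * (x * y))) (*-identityʳ x) ⟩
    x * (x * (x * x))       ≡⟨ *-assoc x x (x * x) ⟨
    x * x * (x * x)         ≡⟨ *-assoc (x * x) x x ⟨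
    x * x * x * x           ∎

  ^4-*ˡ : ∀ a x → (a * x) ^ 4 ≡ a * a * a * a * x ^ 4
  ^4-*ˡ a x = begin
    (a * x) ^ 4                           ≡⟨ ^4-unfold (a * x) ⟩
    (a * x) * (a * x) * (a * x) * (a * x) ≡⟨ solve (a ∷ x ∷ []) ⟩
    a * a * a * a * (x * x * x * x)       ≡⟨ cong (a * a * a * a *_) (^4-unfold x) ⟨
    a * a * a * a * x ^ 4                 ∎

  ^4-ratio : ∀ {a b x y} → x * a ≡ y * b → a * a * a * a * x ^ 4 ≡ b * b * b * b * y ^ 4
  ^4-ratio {a} {b} {x} {y} xa≡yb = begin
    a * a * a * a * x ^ 4 ≡⟨ ^4-*ˡ a x ⟨
    (a * x) ^ 4           ≡⟨ cong (_^ 4) (trans (*-comm a x) (trans xa≡yb (*-comm y b))) ⟩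
    (b * y) ^ 4           ≡⟨ ^4-*ˡ b y ⟩
    b * b * b * b * y ^ 4 ∎

  summand : ℕ → ℕ
  summand n = central n ^ 5 * (205 * n * n + 160 * n + 32)

  term₁ : ℕ → ℕ → ℕ
  term₁ n k = ((n + k ∸ 1) C k) ^ 4 * (2 * k + n)

  F₁ : ℕ → ℕ → ℕ
  F₁ n k = n * central n * term₁ n k

  G₁ : ℕ → ℕ → ℕ
  G₁ n zero    = 0
  G₁ n (suc k) = central n * bin n k ^ 4 * (5 * n * n + 6 * n * suc k + 2 * suc k * suc k)

  wz₁-polynomial : ∀ n k →
    2 * (2 * n + 1) * ((n + k) * (n + k) * (n + k) * (n + k)) * (2 * k + suc n)
      + n * n * n * n * n * (2 * k + n) + k * k * k * k * (5 * n * n + 6 * n * k + 2 * k * k)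
    ≡ (n + k) * (n + k) * (n + k) * (n + k) * (5 * n * n + 6 * n * suc k + 2 * suc k * suc k)
  wz₁-polynomial = solve-∀

  -- The atoms stand for W = C(2n, n), V = C(2n+2, n+1), X⁴ = C(n+k-1, k)⁴, Y⁴ = C(n+k, k)⁴ and G = G₁(n, k).
  wz₁-from-ratios : ∀ n k W V X⁴ Y⁴ G → .{{NonZero n}} →
    suc n * V ≡ 2 * (2 * n + 1) * W →
    n * n * n * n * Y⁴ ≡ (n + k) * (n + k) * (n + k) * (n + k) * X⁴ →
    n * n * n * n * G ≡ W * (k * k * k * k) * X⁴ * (5 * n * n + 6 * n * k + 2 * k * k) →
    suc n * V * (Y⁴ * (2 * k + suc n)) + n * W * (X⁴ * (2 * k + n)) + G
      ≡ W * Y⁴ * (5 * n * n + 6 * n * suc k + 2 * suc k * suc k)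
  wz₁-from-ratios n k W V X⁴ Y⁴ G hV hY hG = *-cancelˡ-≡ _ _ (n * n * n * n) (begin
    n * n * n * n * (suc n * V * (Y⁴ * (2 * k + suc n)) + n * W * (X⁴ * (2 * k + n)) + G)
      ≡⟨ solve (n ∷ k ∷ W ∷ V ∷ X⁴ ∷ Y⁴ ∷ G ∷ []) ⟩
    suc n * V * (n * n * n * n * Y⁴) * (2 * k + suc n) + n * n * n * n * n * W * X⁴ * (2 * k + n) + n * n * n * n * G
      ≡⟨ cong₂ (λ v y → v * y * (2 * k + suc n) + n * n * n * n * n * W * X⁴ * (2 * k + n) + n * n * n * n * G) hV hY ⟩
    2 * (2 * n + 1) * W * ((n + k) * (n + k) * (n + k) * (n + k) * X⁴) * (2 * k + suc n)
      + n * n * n * n * n * W * X⁴ * (2 * k + n) + n * n * n * n * G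
      ≡⟨ cong (2 * (2 * n + 1) * W * ((n + k) * (n + k) * (n + k) * (n + k) * X⁴) * (2 * k + suc n)
               + n * n * n * n * n * W * X⁴ * (2 * k + n) +_) hG ⟩
    2 * (2 * n + 1) * W * ((n + k) * (n + k) * (n + k) * (n + k) * X⁴) * (2 * k + suc n)
      + n * n * n * n * n * W * X⁴ * (2 * k + n) + W * (k * k * k * k) * X⁴ * (5 * n * n + 6 * n * k + 2 * k * k)
      ≡⟨ solve (n ∷ k ∷ W ∷ X⁴ ∷ []) ⟩
    W * X⁴ * (2 * (2 * n + 1) * ((n + k) * (n + k) * (n + k) * (n + k)) * (2 * k + suc n)
      + n * n * n * n * n * (2 * k + n) + k * k * k * k * (5 * n * n + 6 * n * k + 2 * k * k))
      ≡⟨ cong (W * X⁴ *_) (wz₁-polynomial n k) ⟩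
    W * X⁴ * ((n + k) * (n + k) * (n + k) * (n + k) * (5 * n * n + 6 * n * suc k + 2 * suc k * suc k))
      ≡⟨ solve (n ∷ k ∷ W ∷ X⁴ ∷ []) ⟩
    W * ((n + k) * (n + k) * (n + k) * (n + k) * X⁴) * (5 * n * n + 6 * n * suc k + 2 * suc k * suc k)
      ≡⟨ cong (λ y → W * y * (5 * n * n + 6 * n * suc k + 2 * suc k * suc k)) hY ⟨
    W * (n * n * n * n * Y⁴) * (5 * n * n + 6 * n * suc k + 2 * suc k * suc k)
      ≡⟨ solve (n ∷ k ∷ W ∷ Y⁴ ∷ []) ⟩
    n * n * n * n * (W * Y⁴ * (5 * n * n + 6 * n * suc k + 2 * suc k * suc k)) ∎)
    where
    instance
      _ = m*n≢0 n n
      _ = m*n≢0 (n * n) n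
      _ = m*n≢0 (n * n * n) n

  G₁-ratio : ∀ m k → let n = suc m in
    n * n * n * n * G₁ n k ≡ central n * (k * k * k * k) * bin m k ^ 4 * (5 * n * n + 6 * n * k + 2 * k * k)
  G₁-ratio m zero    = trans (*-zeroʳ (n * n * n * n))
                             (cong (λ x → x * bin m 0 ^ 4 * (5 * n * n + 6 * n * 0 + 2 * 0 * 0)) (sym (*-zeroʳ (central n))))
    where n = suc m
  G₁-ratio m (suc j) =
    rescale n (suc j) (bin n j ^ 4) (bin m (suc j) ^ 4) (central n) (5 * n * n + 6 * n * suc j + 2 * suc j * suc j)
      (^4-ratio {x = bin n j} {y = bin m (suc j)} (bin-shift m j))
    where
    n = suc m
    rescale : ∀ a b Z X W p → a * a * a * a * Z ≡ b * b * b * b * X →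
      a * a * a * a * (W * Z * p) ≡ W * (b * b * b * b) * X * p
    rescale a b Z X W p aZ≡bX = begin
      a * a * a * a * (W * Z * p) ≡⟨ solve (a ∷ Z ∷ W ∷ p ∷ []) ⟩
      W * (a * a * a * a * Z) * p ≡⟨ cong (λ z → W * z * p) aZ≡bX ⟩
      W * (b * b * b * b * X) * p ≡⟨ solve (b ∷ X ∷ W ∷ p ∷ []) ⟩
      W * (b * b * b * b) * X * p ∎

  wz₁-pair : ∀ m k → let n = suc m in F₁ (suc n) k + F₁ n k + G₁ n k ≡ G₁ n (suc k)
  wz₁-pair m k = wz₁-from-ratios n k (central n) (central (suc n)) (bin m k ^ 4) (bin n k ^ 4) (G₁ n k)
    (central-suc n) (^4-ratio {x = bin n k} {y = bin m k} (bin-sucˡ m k)) (G₁-ratio m k)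
    where n = suc m

  boundary₁-from-ratio : ∀ n W W⁴ H⁴ → W⁴ ≡ 16 * H⁴ →
    16 * (W * W⁴ * (5 * n * n + 6 * n * suc n + 2 * suc n * suc n))
      ≡ W * W⁴ * (205 * n * n + 160 * n + 32) + 16 * (n * W * (H⁴ * (2 * n + n)))
  boundary₁-from-ratio n W _ H⁴ refl = solve (n ∷ W ∷ H⁴ ∷ [])

  boundary₁ : ∀ m → let n = suc m in 16 * G₁ n (suc n) ≡ summand n + 16 * F₁ n n
  boundary₁ m = begin
    16 * (central n * bin n n ^ 4 * p)
      ≡⟨ cong (λ c → 16 * (central n * c ^ 4 * p)) (central≡bin n) ⟨
    16 * (central n * central n ^ 4 * p)
      ≡⟨ boundary₁-from-ratio n (central n) (central n ^ 4) (bin m n ^ 4) W⁴≡16H⁴ ⟩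
    summand n + 16 * F₁ n n ∎
    where
    n = suc m
    p = 5 * n * n + 6 * n * suc n + 2 * suc n * suc n
    W⁴≡16H⁴ : central n ^ 4 ≡ 16 * bin m n ^ 4
    W⁴≡16H⁴ = trans (cong (_^ 4) (central-suc≡2*bin m)) (^4-*ˡ 2 (bin m n))

  Bℕ : ℕ → ℕ
  Bℕ n = 16 * n * central n * sumℕ n (term₁ n)

  Bℕ-recurrence : ∀ n → Bℕ (suc n) + Bℕ n ≡ summand n
  Bℕ-recurrence zero    = refl
  Bℕ-recurrence (suc m) = +-cancelʳ-≡ (16 * F₁ n n) _ _ (begin
    Bℕ (suc n) + Bℕ n + 16 * F₁ n n
      ≡⟨ regroup (suc n) (central (suc n)) (sumℕ (suc n) (term₁ (suc n))) n (central n) (sumℕ n (term₁ n)) (F₁ n n) ⟩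
    16 * (suc n * central (suc n) * sumℕ (suc n) (term₁ (suc n)) + (n * central n * sumℕ n (term₁ n) + F₁ n n))
      ≡⟨ cong₂ (λ x y → 16 * (x + (y + F₁ n n))) (sumℕ-*ˡ (suc n) (suc n * central (suc n)) (term₁ (suc n)))
                                                 (sumℕ-*ˡ n (n * central n) (term₁ n)) ⟨
    16 * (sumℕ (suc n) (F₁ (suc n)) + sumℕ (suc n) (F₁ n))
      ≡⟨ cong (16 *_) (sumℕ-+ (suc n) (F₁ (suc n)) (F₁ n)) ⟨
    16 * sumℕ (suc n) (λ k → F₁ (suc n) k + F₁ n k)
      ≡⟨ cong (16 *_) (sumℕ-telescope (suc n) _ (G₁ n) refl (wz₁-pair m)) ⟩
    16 * G₁ n (suc n)
      ≡⟨ boundary₁ m ⟩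
    summand n + 16 * F₁ n n ∎)
    where
    n = suc m
    regroup : ∀ a b c d e f g → 16 * a * b * c + 16 * d * e * f + 16 * g ≡ 16 * (a * b * c + (d * e * f + g))
    regroup = solve-∀

module SecondIdentity where

  open import Data.List using (_∷_; [])
  open import Data.Nat
  open import Data.Nat.Properties
  open import Data.Nat.Combinatorics using (_C_)
  open import Data.Nat.Tactic.RingSolver using (solve)
  open import Relation.Binary.PropositionalEquality
  open ≡-Reasoning
  open Binomial
  open FirstIdentity using (summand; ^4-unfold)

  term₂ : ℕ → ℕ → ℕ
  term₂ n k = ((2 * n ∸ 1) C (n + k)) * ((2 * n ∸ k ∸ 2) C (n ∸ k ∸ 1)) * ((2 * n ∸ k ∸ 2) C (n ∸ k ∸ 1))

  c₂ : ℕ → ℕ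
  c₂ n = 8 * n * n * central n * central n

  q : ℕ → ℕ → ℕ
  q n j = 8 * j + 11 * n + 21 * n * j + 30 * n * n

  G₂ : ℕ → ℕ → ℕ
  G₂ n zero    = 0
  G₂ n (suc i) = ((2 * n) C i) * bin n i * bin n i * q n (suc i)

  wz₂-polynomial : ∀ {n} r k → n ≡ suc (r + k) →
    8 * ((2 * n + 1) * (2 * n + 1)) * suc (suc (n + k) + r) * suc (n + k + r) * ((n + r) * (n + r))
      ≡ 2 * (n * n * n * n) * suc (suc (n + k)) * suc (n + k)
        + suc (suc (n + k)) * suc (n + k + r) * ((n + r) * (n + r)) * (8 * suc r + 11 * n + 21 * n * suc r + 30 * n * n)
        + suc (n + k + r) * (r * r * r) * (8 * r + 11 * n + 21 * n * r + 30 * n * n)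
  wz₂-polynomial r k refl = solve (r ∷ k ∷ [])

  -- With r = n - 1 - k, the atoms stand for A = C(2n-1, r), A′ = C(2n, r), A″ = C(2n+1, r), B = C(2n-k-2, r),
  -- B′ = C(2n-k-1, r), W = C(2n, n), V = C(2n+2, n+1) and G = G₂(n, r).
  wz₂-from-ratios : ∀ n r k W V A A′ A″ B B′ G → n ≡ suc (r + k) →
    suc n * V ≡ 2 * (2 * n + 1) * W →
    A′ * suc (n + k) ≡ A * suc (n + k + r) →
    A″ * suc (suc (n + k)) ≡ A′ * suc (suc (n + k) + r) →
    B′ * n ≡ B * (n + r) →
    suc (suc (n + k)) * suc (n + k) * n * n * G
      ≡ suc (n + k + r) * (r * r * r) * A * B * B * (8 * r + 11 * n + 21 * n * r + 30 * n * n) →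
    8 * suc n * suc n * V * V * (A″ * B′ * B′)
      ≡ 8 * n * n * W * W * (A * B * B) + 4 * (W * W) * (A′ * B′ * B′ * (8 * suc r + 11 * n + 21 * n * suc r + 30 * n * n) + G)
  wz₂-from-ratios n r k W V A A′ A″ B B′ G n≡1+r+k hV hA′ hA″ hB′ hG =
    *-cancelˡ-≡ _ _ (suc (suc (n + k)) * suc (n + k) * n * n)
      (trans scaled-lhs (trans (cong (4 * (W * W) * (A * B * B) *_) (wz₂-polynomial r k n≡1+r+k)) (sym scaled-rhs)))
    where
    instance
      _ = subst NonZero (sym n≡1+r+k) _
      _ = m*n≢0 (suc (suc (n + k))) (suc (n + k))
      _ = m*n≢0 (suc (suc (n + k)) * suc (n + k)) n
      _ = m*n≢0 (suc (suc (n + k)) * suc (n + k) * n) n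

    scaled-lhs : suc (suc (n + k)) * suc (n + k) * n * n * (8 * suc n * suc n * V * V * (A″ * B′ * B′))
      ≡ 4 * (W * W) * (A * B * B) * (8 * ((2 * n + 1) * (2 * n + 1)) * suc (suc (n + k) + r) * suc (n + k + r) * ((n + r) * (n + r)))
    scaled-lhs = begin
      suc (suc (n + k)) * suc (n + k) * n * n * (8 * suc n * suc n * V * V * (A″ * B′ * B′))
        ≡⟨ solve (n ∷ k ∷ V ∷ A″ ∷ B′ ∷ []) ⟩
      8 * (suc n * V) * (suc n * V) * (A″ * suc (suc (n + k))) * suc (n + k) * (B′ * n) * (B′ * n)
        ≡⟨ cong₂ (λ v a → 8 * v * v * a * suc (n + k) * (B′ * n) * (B′ * n)) hV hA″ ⟩
      8 * (2 * (2 * n + 1) * W) * (2 * (2 * n + 1) * W) * (A′ * suc (suc (n + k) + r)) * suc (n + k) * (B′ * n) * (B′ * n)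
        ≡⟨ cong (λ b → 8 * (2 * (2 * n + 1) * W) * (2 * (2 * n + 1) * W) * (A′ * suc (suc (n + k) + r)) * suc (n + k) * b * b) hB′ ⟩
      8 * (2 * (2 * n + 1) * W) * (2 * (2 * n + 1) * W) * (A′ * suc (suc (n + k) + r)) * suc (n + k) * (B * (n + r)) * (B * (n + r))
        ≡⟨ solve (n ∷ r ∷ k ∷ W ∷ A′ ∷ B ∷ []) ⟩
      32 * ((2 * n + 1) * (2 * n + 1)) * (W * W) * suc (suc (n + k) + r) * (A′ * suc (n + k)) * (B * B) * ((n + r) * (n + r))
        ≡⟨ cong (λ a → 32 * ((2 * n + 1) * (2 * n + 1)) * (W * W) * suc (suc (n + k) + r) * a * (B * B) * ((n + r) * (n + r))) hA′ ⟩
      32 * ((2 * n + 1) * (2 * n + 1)) * (W * W) * suc (suc (n + k) + r) * (A * suc (n + k + r)) * (B * B) * ((n + r) * (n + r))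
        ≡⟨ solve (n ∷ r ∷ k ∷ W ∷ A ∷ B ∷ []) ⟩
      4 * (W * W) * (A * B * B) * (8 * ((2 * n + 1) * (2 * n + 1)) * suc (suc (n + k) + r) * suc (n + k + r) * ((n + r) * (n + r))) ∎

    scaled-rhs : suc (suc (n + k)) * suc (n + k) * n * n
                   * (8 * n * n * W * W * (A * B * B) + 4 * (W * W) * (A′ * B′ * B′ * (8 * suc r + 11 * n + 21 * n * suc r + 30 * n * n) + G))
      ≡ 4 * (W * W) * (A * B * B) * (2 * (n * n * n * n) * suc (suc (n + k)) * suc (n + k)
          + suc (suc (n + k)) * suc (n + k + r) * ((n + r) * (n + r)) * (8 * suc r + 11 * n + 21 * n * suc r + 30 * n * n)
          + suc (n + k + r) * (r * r * r) * (8 * r + 11 * n + 21 * n * r + 30 * n * n))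
    scaled-rhs = begin
      suc (suc (n + k)) * suc (n + k) * n * n
        * (8 * n * n * W * W * (A * B * B) + 4 * (W * W) * (A′ * B′ * B′ * (8 * suc r + 11 * n + 21 * n * suc r + 30 * n * n) + G))
        ≡⟨ solve (n ∷ r ∷ k ∷ W ∷ A ∷ A′ ∷ B ∷ B′ ∷ G ∷ []) ⟩
      suc (suc (n + k)) * suc (n + k) * n * n * (8 * n * n * W * W * (A * B * B))
        + 4 * (W * W) * (suc (suc (n + k)) * (A′ * suc (n + k)) * (B′ * n) * (B′ * n) * (8 * suc r + 11 * n + 21 * n * suc r + 30 * n * n))
        + 4 * (W * W) * (suc (suc (n + k)) * suc (n + k) * n * n * G)
        ≡⟨ cong₂ (λ a b → suc (suc (n + k)) * suc (n + k) * n * n * (8 * n * n * W * W * (A * B * B))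
                          + 4 * (W * W) * (suc (suc (n + k)) * a * b * b * (8 * suc r + 11 * n + 21 * n * suc r + 30 * n * n))
                          + 4 * (W * W) * (suc (suc (n + k)) * suc (n + k) * n * n * G))
                 hA′ hB′ ⟩
      suc (suc (n + k)) * suc (n + k) * n * n * (8 * n * n * W * W * (A * B * B))
        + 4 * (W * W) * (suc (suc (n + k)) * (A * suc (n + k + r)) * (B * (n + r)) * (B * (n + r)) * (8 * suc r + 11 * n + 21 * n * suc r + 30 * n * n))
        + 4 * (W * W) * (suc (suc (n + k)) * suc (n + k) * n * n * G)
        ≡⟨ cong (λ g → suc (suc (n + k)) * suc (n + k) * n * n * (8 * n * n * W * W * (A * B * B))
                       + 4 * (W * W) * (suc (suc (n + k)) * (A * suc (n + k + r)) * (B * (n + r)) * (B * (n + r))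
                                          * (8 * suc r + 11 * n + 21 * n * suc r + 30 * n * n))
                       + 4 * (W * W) * g) hG ⟩
      suc (suc (n + k)) * suc (n + k) * n * n * (8 * n * n * W * W * (A * B * B))
        + 4 * (W * W) * (suc (suc (n + k)) * (A * suc (n + k + r)) * (B * (n + r)) * (B * (n + r)) * (8 * suc r + 11 * n + 21 * n * suc r + 30 * n * n))
        + 4 * (W * W) * (suc (n + k + r) * (r * r * r) * A * B * B * (8 * r + 11 * n + 21 * n * r + 30 * n * n))
        ≡⟨ solve (n ∷ r ∷ k ∷ W ∷ A ∷ B ∷ []) ⟩
      4 * (W * W) * (A * B * B) * (2 * (n * n * n * n) * suc (suc (n + k)) * suc (n + k)
          + suc (suc (n + k)) * suc (n + k + r) * ((n + r) * (n + r)) * (8 * suc r + 11 * n + 21 * n * suc r + 30 * n * n)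
          + suc (n + k + r) * (r * r * r) * (8 * r + 11 * n + 21 * n * r + 30 * n * n)) ∎

  m≡n+o⇒m∸o≡n : ∀ {m} n o → m ≡ n + o → m ∸ o ≡ n
  m≡n+o⇒m∸o≡n n o refl = m+n∸n≡m n o

  term₂-split : ∀ {n k} r → n ≡ suc (r + k) → term₂ n k ≡ bin (n + k) r * bin (r + k) r * bin (r + k) r
  term₂-split {k = k} r refl = cong₂ (λ a b → a * b * b) first second
    where
    top : 2 * suc (r + k) ≡ r + (suc (r + k) + k) + 1
    top = solve (r ∷ k ∷ [])
    first : (2 * suc (r + k) ∸ 1) C (suc (r + k) + k) ≡ bin (suc (r + k) + k) r
    first = trans (cong (_C (suc (r + k) + k)) (m≡n+o⇒m∸o≡n _ 1 top)) (sym (bin-sym (suc (r + k) + k) r))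
    top′ : 2 * suc (r + k) ≡ r + k + r + 2 + k
    top′ = solve (r ∷ k ∷ [])
    bottom : suc (r + k) ≡ r + 1 + k
    bottom = solve (r ∷ k ∷ [])
    second : (2 * suc (r + k) ∸ k ∸ 2) C (suc (r + k) ∸ k ∸ 1) ≡ bin (r + k) r
    second = cong₂ _C_ (m≡n+o⇒m∸o≡n _ 2 (m≡n+o⇒m∸o≡n _ k top′))
                       (m≡n+o⇒m∸o≡n r 1 (m≡n+o⇒m∸o≡n _ k bottom))

  G₂-ratio : ∀ r k → let n = suc (r + k) in
    suc (suc (n + k)) * suc (n + k) * n * n * G₂ n r
      ≡ suc (n + k + r) * (r * r * r) * bin (n + k) r * bin (r + k) r * bin (r + k) r * q n r
  G₂-ratio zero    k = trans (*-zeroʳ (suc (suc (suc k + k)) * suc (suc k + k) * suc k * suc k))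
                             (cong (λ x → x * bin (suc k + k) 0 * bin k 0 * bin k 0 * q (suc k) 0)
                                   (sym (*-zeroʳ (suc (suc k + k + 0)))))
  G₂-ratio (suc s) k = begin
    suc (suc (n + k)) * suc (n + k) * n * n * (((2 * n) C s) * bin n s * bin n s * q n (suc s))
      ≡⟨ cong (λ c → suc (suc (n + k)) * suc (n + k) * n * n * (c * bin n s * bin n s * q n (suc s))) (cong (_C s) top) ⟩
    suc (suc (n + k)) * suc (n + k) * n * n * (bin (suc (suc (n + k))) s * bin n s * bin n s * q n (suc s))
      ≡⟨ combine n k s (bin (suc (suc (n + k))) s) (bin (suc (n + k)) s) (bin (n + k) (suc s)) (bin n s) (bin (suc s + k) (suc s))
            (q n (suc s))
            (bin-sucˡ (suc (n + k)) s) (bin-shift (n + k) s) (bin-shift (suc s + k) s) ⟩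
    suc (n + k + suc s) * (suc s * suc s * suc s) * bin (n + k) (suc s) * bin (suc s + k) (suc s) * bin (suc s + k) (suc s)
      * q n (suc s) ∎
    where
    n = suc (suc s + k)
    top : 2 * suc (suc s + k) ≡ suc (suc (suc (suc s + k) + k)) + s
    top = solve (s ∷ k ∷ [])
    combine : ∀ n k s C M A Z B p →
      C * suc (suc (n + k)) ≡ M * suc (suc (n + k) + s) → M * suc (n + k) ≡ A * suc s → Z * n ≡ B * suc s →
      suc (suc (n + k)) * suc (n + k) * n * n * (C * Z * Z * p) ≡ suc (n + k + suc s) * (suc s * suc s * suc s) * A * B * B * p
    combine n k s C M A Z B p hC hM hZ = begin
      suc (suc (n + k)) * suc (n + k) * n * n * (C * Z * Z * p)
        ≡⟨ solve (n ∷ k ∷ C ∷ Z ∷ p ∷ []) ⟩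
      (C * suc (suc (n + k))) * suc (n + k) * (Z * n) * (Z * n) * p
        ≡⟨ cong₂ (λ c z → c * suc (n + k) * z * z * p) hC hZ ⟩
      (M * suc (suc (n + k) + s)) * suc (n + k) * (B * suc s) * (B * suc s) * p
        ≡⟨ solve (n ∷ k ∷ s ∷ M ∷ B ∷ p ∷ []) ⟩
      suc (suc (n + k) + s) * (M * suc (n + k)) * (B * suc s) * (B * suc s) * p
        ≡⟨ cong (λ m → suc (suc (n + k) + s) * m * (B * suc s) * (B * suc s) * p) hM ⟩
      suc (suc (n + k) + s) * (A * suc s) * (B * suc s) * (B * suc s) * p
        ≡⟨ solve (n ∷ k ∷ s ∷ A ∷ B ∷ p ∷ []) ⟩
      suc (n + k + suc s) * (suc s * suc s * suc s) * A * B * B * p ∎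

  wz₂-pair : ∀ r k → let n = suc (r + k) in
    c₂ (suc n) * term₂ (suc n) (suc k) ≡ c₂ n * term₂ n k + 4 * (central n * central n) * (G₂ n (suc r) + G₂ n r)
  wz₂-pair r k = begin
    c₂ (suc n) * term₂ (suc n) (suc k)
      ≡⟨ cong (c₂ (suc n) *_) next ⟩
    c₂ (suc n) * (bin (suc (suc (n + k))) r * bin n r * bin n r)
      ≡⟨ wz₂-from-ratios n r k (central n) (central (suc n)) (bin (n + k) r) (bin (suc (n + k)) r) (bin (suc (suc (n + k))) r)
           (bin (r + k) r) (bin n r) (G₂ n r) refl
           (central-suc n) (bin-sucˡ (n + k) r) (bin-sucˡ (suc (n + k)) r) (bin-sucˡ (r + k) r) (G₂-ratio r k) ⟩
    8 * n * n * central n * central n * (bin (n + k) r * bin (r + k) r * bin (r + k) r)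
      + 4 * (central n * central n) * (bin (suc (n + k)) r * bin n r * bin n r * q n (suc r) + G₂ n r)
      ≡⟨ cong₂ (λ t c → 8 * n * n * central n * central n * t
                        + 4 * (central n * central n) * (c * bin n r * bin n r * q n (suc r) + G₂ n r))
               (term₂-split r refl) (cong (_C r) top) ⟨
    c₂ n * term₂ n k + 4 * (central n * central n) * (G₂ n (suc r) + G₂ n r) ∎
    where
    n = suc (r + k)
    top : 2 * suc (r + k) ≡ suc (suc (r + k) + k) + r
    top = solve (r ∷ k ∷ [])
    next : term₂ (suc n) (suc k) ≡ bin (suc (suc (n + k))) r * bin n r * bin n r
    next = trans (term₂-split r (cong suc (sym (+-suc r k))))
                 (cong₂ (λ a b → bin a r * bin b r * bin b r) (cong suc (+-suc n k)) (+-suc r k))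

  wz₂-pair-< : ∀ {n k} → k < n → let W² = central n * central n in
    c₂ (suc n) * term₂ (suc n) (suc k) ≡ c₂ n * term₂ n k + (4 * W² * G₂ n (n ∸ k) + 4 * W² * G₂ n (n ∸ suc k))
  wz₂-pair-< {suc n} {k} (s≤s k≤n) = subst P (m∸n+n≡m k≤n) (pair (n ∸ k))
    where
    P : ℕ → Set
    P m = let W² = central (suc m) * central (suc m) in
      c₂ (suc (suc m)) * term₂ (suc (suc m)) (suc k)
        ≡ c₂ (suc m) * term₂ (suc m) k + (4 * W² * G₂ (suc m) (suc m ∸ k) + 4 * W² * G₂ (suc m) (suc m ∸ suc k))
    pair : ∀ r → P (r + k)
    pair r = begin
      c₂ (suc n′) * term₂ (suc n′) (suc k)                                ≡⟨ wz₂-pair r k ⟩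
      c₂ n′ * term₂ n′ k + 4 * W² * (G₂ n′ (suc r) + G₂ n′ r)             ≡⟨ cong (c₂ n′ * term₂ n′ k +_) (*-distribˡ-+ (4 * W²) _ _) ⟩
      c₂ n′ * term₂ n′ k + (4 * W² * G₂ n′ (suc r) + 4 * W² * G₂ n′ r)
        ≡⟨ cong₂ (λ i j → c₂ n′ * term₂ n′ k + (4 * W² * G₂ n′ i + 4 * W² * G₂ n′ j)) (m+n∸n≡m (suc r) k) (m+n∸n≡m r k) ⟨
      c₂ n′ * term₂ n′ k + (4 * W² * G₂ n′ (n′ ∸ k) + 4 * W² * G₂ n′ (n′ ∸ suc k)) ∎
      where
      n′ = suc (r + k)
      W² = central n′ * central n′

  boundary₂-from-ratios : ∀ n V P Q H W W⁴ → W ≡ 2 * H → W⁴ ≡ W * W * W * W →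
    suc n * V ≡ 2 * (2 * n + 1) * W → P * suc n ≡ W * suc (n + n) → Q * suc n ≡ H * (2 * n) →
    8 * suc n * suc n * V * V * (P * W * W)
      ≡ W * W⁴ * (205 * n * n + 160 * n + 32) + 4 * (W * W) * (Q * H * H * (8 * n + 11 * n + 21 * n * n + 30 * n * n))
  boundary₂-from-ratios n V P Q H _ _ refl refl hV hP hQ = *-cancelˡ-≡ _ _ (suc n) (begin
    suc n * (8 * suc n * suc n * V * V * (P * (2 * H) * (2 * H)))
      ≡⟨ solve (n ∷ V ∷ P ∷ H ∷ []) ⟩
    8 * (suc n * V) * (suc n * V) * (P * suc n) * (2 * H) * (2 * H)
      ≡⟨ cong₂ (λ v p → 8 * v * v * p * (2 * H) * (2 * H)) hV hP ⟩
    8 * (2 * (2 * n + 1) * (2 * H)) * (2 * (2 * n + 1) * (2 * H)) * (2 * H * suc (n + n)) * (2 * H) * (2 * H)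
      ≡⟨ solve (n ∷ H ∷ []) ⟩
    suc n * (2 * H * (2 * H * (2 * H) * (2 * H) * (2 * H)) * (205 * n * n + 160 * n + 32))
      + 4 * (2 * H * (2 * H)) * (H * (2 * n) * H * H * (8 * n + 11 * n + 21 * n * n + 30 * n * n))
      ≡⟨ cong (λ x → suc n * (2 * H * (2 * H * (2 * H) * (2 * H) * (2 * H)) * (205 * n * n + 160 * n + 32))
                     + 4 * (2 * H * (2 * H)) * (x * H * H * (8 * n + 11 * n + 21 * n * n + 30 * n * n))) hQ ⟨
    suc n * (2 * H * (2 * H * (2 * H) * (2 * H) * (2 * H)) * (205 * n * n + 160 * n + 32))
      + 4 * (2 * H * (2 * H)) * (Q * suc n * H * H * (8 * n + 11 * n + 21 * n * n + 30 * n * n))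
      ≡⟨ solve (n ∷ Q ∷ H ∷ []) ⟩
    suc n * (2 * H * (2 * H * (2 * H) * (2 * H) * (2 * H)) * (205 * n * n + 160 * n + 32)
      + 4 * (2 * H * (2 * H)) * (Q * H * H * (8 * n + 11 * n + 21 * n * n + 30 * n * n))) ∎)

  boundary₂ : ∀ n → c₂ (suc n) * term₂ (suc n) 0 ≡ summand n + 4 * (central n * central n) * G₂ n n
  boundary₂ zero    = refl
  boundary₂ (suc m) = begin
    c₂ (suc n) * term₂ (suc n) 0
      ≡⟨ cong (c₂ (suc n) *_) (term₂-split n (cong suc (sym (+-identityʳ n)))) ⟩
    c₂ (suc n) * (bin (suc n + 0) n * bin (n + 0) n * bin (n + 0) n)
      ≡⟨ cong₂ (λ a b → c₂ (suc n) * (bin a n * b * b))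
               (+-identityʳ (suc n)) (trans (cong (λ a → bin a n) (+-identityʳ n)) (sym (central≡bin n))) ⟩
    c₂ (suc n) * (bin (suc n) n * central n * central n)
      ≡⟨ boundary₂-from-ratios n (central (suc n)) (bin (suc n) n) (bin (suc (suc m)) m) (bin n m) (central n) (central n ^ 4)
           (trans (central-suc≡2*bin m) (cong (2 *_) (bin-sym m n))) (^4-unfold (central n)) (central-suc n)
           (trans (bin-sucˡ n n) (cong (_* suc (n + n)) (sym (central≡bin n))))
           (trans (bin-sucˡ (suc m) m) (cong (bin n m *_) double)) ⟩
    summand n + 4 * (central n * central n) * (bin (suc (suc m)) m * bin n m * bin n m * q n n)
      ≡⟨ cong (λ c → summand n + 4 * (central n * central n) * (c * bin n m * bin n m * q n n)) (cong (_C m) top) ⟨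
    summand n + 4 * (central n * central n) * G₂ n n ∎
    where
    n = suc m
    top : 2 * suc m ≡ suc (suc m) + m
    top = solve (m ∷ [])
    double : suc (suc m + m) ≡ 2 * suc m
    double = solve (m ∷ [])

open import Data.Nat using (ℕ; suc; _∸_; _<_; _≥_) renaming (_+_ to _+ℕ_; _*_ to _*ℕ_; _^_ to _^ℕ_)
open import Data.Nat.Properties using (n∸n≡0; *-zeroʳ)
open import Data.Nat.Combinatorics using (_C_)
open import Data.Integer using (ℤ; +_; _+_; _*_; _-_)
open import Data.Integer.Properties using (pos-+; pos-*)
open import Data.Integer.Tactic.RingSolver using (solve-∀)
open import Data.Product using (_×_; _,_)
open import Relation.Binary.PropositionalEquality
open ≡-Reasoning
open Sums
open Binomial using (central)
open FirstIdentity using (summand; term₁; Bℕ; Bℕ-recurrence)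
open SecondIdentity using (term₂; c₂; G₂; wz₂-pair-<; boundary₂)

A : ℕ → ℤ
A n = sumTo n (λ k → sign (n ∸ 1 ∸ k) * + (central k ^ℕ 5) * + (205 *ℕ k *ℕ k +ℕ 160 *ℕ k +ℕ 32))

B : ℕ → ℤ
B n = + (16 *ℕ n *ℕ central n) * sumTo n (λ k → + term₁ n k)

D : ℕ → ℤ
D n = + c₂ n * sumTo n (λ k → sign k * + term₂ n k)

A-recurrence : ∀ n → A (suc n) + A n ≡ + summand n
A-recurrence n = trans (sumTo-reversed-alternating n _ _) (sym (pos-* (central n ^ℕ 5) _))

B≡Bℕ : ∀ n → B n ≡ + Bℕ n
B≡Bℕ n = trans (cong (+ (16 *ℕ n *ℕ central n) *_) (sumTo-pos n (term₁ n))) (sym (pos-* (16 *ℕ n *ℕ central n) _))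

B-recurrence : ∀ n → B (suc n) + B n ≡ + summand n
B-recurrence n = begin
  B (suc n) + B n          ≡⟨ cong₂ _+_ (B≡Bℕ (suc n)) (B≡Bℕ n) ⟩
  + Bℕ (suc n) + + Bℕ n    ≡⟨ pos-+ (Bℕ (suc n)) (Bℕ n) ⟨
  + (Bℕ (suc n) +ℕ Bℕ n)   ≡⟨ cong +_ (Bℕ-recurrence n) ⟩
  + summand n              ∎

D≡alternating-sum : ∀ n → D n ≡ sumTo n (λ k → sign k * + (c₂ n *ℕ term₂ n k))
D≡alternating-sum n = trans (sym (sumTo-*ˡ n (+ c₂ n) _)) (sumTo-cong n (λ {k} _ → move (sign k) (c₂ n) (term₂ n k)))
  where
  move : ∀ s c t → + c * (s * + t) ≡ s * + (c *ℕ t)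
  move s c t = trans (swap (+ c) s (+ t)) (cong (s *_) (sym (pos-* c t)))
    where
    swap : ∀ x y z → x * (y * z) ≡ y * (x * z)
    swap = solve-∀

D-recurrence : ∀ n → D (suc n) + D n ≡ + summand n
D-recurrence n = begin
  D (suc n) + D n
    ≡⟨ cong₂ _+_ (D≡alternating-sum (suc n)) (D≡alternating-sum n) ⟩
  sumTo (suc n) (λ k → sign k * b k) + sumTo n (λ k → sign k * a k)
    ≡⟨ sumTo-alternating-shift n a b h b≡a+h ⟩
  b 0 - (h 0 - sign n * h n)
    ≡⟨ cong₂ (λ x y → x - (h 0 - sign n * + y)) (trans (cong +_ (boundary₂ n)) (pos-+ (summand n) _)) vanish ⟩
  + summand n + h 0 - (h 0 - sign n * + 0)
    ≡⟨ simplify (+ summand n) (h 0) (sign n) ⟩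
  + summand n ∎
  where
  W² = central n *ℕ central n
  a b h : ℕ → ℤ
  a k = + (c₂ n *ℕ term₂ n k)
  b k = + (c₂ (suc n) *ℕ term₂ (suc n) k)
  h k = + (4 *ℕ W² *ℕ G₂ n (n ∸ k))
  b≡a+h : ∀ {k} → k < n → b (suc k) ≡ a k + (h k + h (suc k))
  b≡a+h {k} k<n = trans (cong +_ (wz₂-pair-< k<n))
    (trans (pos-+ (c₂ n *ℕ term₂ n k) (4 *ℕ W² *ℕ G₂ n (n ∸ k) +ℕ 4 *ℕ W² *ℕ G₂ n (n ∸ suc k)))
           (cong (_+_ (a k)) (pos-+ (4 *ℕ W² *ℕ G₂ n (n ∸ k)) (4 *ℕ W² *ℕ G₂ n (n ∸ suc k)))))
  vanish : 4 *ℕ W² *ℕ G₂ n (n ∸ n) ≡ 0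
  vanish = trans (cong (λ m → 4 *ℕ W² *ℕ G₂ n m) (n∸n≡0 n)) (*-zeroʳ (4 *ℕ W²))
  simplify : ∀ s g σ → s + g - (g - σ * + 0) ≡ s
  simplify = solve-∀

theorem7 : (n : ℕ) → n ≥ 1 →
    let A = sumTo n (λ k → sign (n ∸ 1 ∸ k) * (+ (((2 *ℕ k) C k) ^ℕ 5)) * (+ (205 *ℕ k *ℕ k +ℕ 160 *ℕ k +ℕ 32)))
    in (A ≡ + (16 *ℕ n *ℕ ((2 *ℕ n) C n)) * sumTo n (λ k → + (((n +ℕ k ∸ 1) C k) ^ℕ 4 *ℕ (2 *ℕ k +ℕ n))))
       × (A ≡ + (8 *ℕ n *ℕ n *ℕ ((2 *ℕ n) C n) *ℕ ((2 *ℕ n) C n)) * sumTo n (λ k → sign k * (+ (((2 *ℕ n ∸ 1) C (n +ℕ k)) *ℕ ((2 *ℕ n ∸ k ∸ 2) C (n ∸ k ∸ 1)) *ℕ ((2 *ℕ n ∸ k ∸ 2) C (n ∸ k ∸ 1))))))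
theorem7 n _ = recurrence-unique A B _ refl A-recurrence B-recurrence n
             , recurrence-unique A D _ refl A-recurrence D-recurrence n
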